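{- Let $G$ be a finite abelian group, $n\geq2$, $A=G^\vee$ (written additively), $G'\subsetneq G$ a cyclic subgroup, and $A''\subseteq A$ the subgroup of characters trivial on $G'$ (identified with $(G/G')^\vee$). Let $b_1,\dots,b_{n-1}\in A''$ with $\sum_i\mathbb{Z}b_i=A''$, and let $a_1,a_2\in A$ with $a_2-a_1\in A''$ and such that the restriction of $a_1$ to $G'$ generates $(G')^\vee$. Then in $\mathcal{M}_n(G)$, $$\langle a_1,b_1,\dots,b_{n-1}\rangle+\langle -a_1,b_1,\dots,b_{n-1}\rangle=\langle a_2,b_1,\dots,b_{n-1}\rangle+\langle -a_2,b_1,\dots,b_{n-1}\rangle.$$
   Context: For a finite abelian group $G$ and $n\geq1$, $\mathcal{M}_n(G)$ is the quotient of the free $\mathbb{Z}$-module on $n$-tuples $(c_1,\dots,c_n)$ of elements of $G^\vee$ with $\sum_j\mathbb{Z}c_j=G^\vee$ by the relations (O) $(c_1,\dots,c_n)=(c_{\sigma(1)},\dots,c_{\sigma(n)})$ for all permutations $\sigma$, and (for $n\geq2$) (M) $(c_1,c_2,c_3,\dots,c_n)=(c_1-c_2,c_2,c_3,\dots,c_n)+(c_1,c_2-c_1,c_3,\dots,c_n)$. The class of $(c_1,\dots,c_n)$ is denoted $\langle c_1,\dots,c_n\rangle$. (Under the hypotheses, the tuples $(\pm a_i,b_1,\dots,b_{n-1})$ generate $A$.) -}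

module Defs where

open import Data.Nat as ℕ using (ℕ; zero; suc)
open import Data.Nat.DivMod using (_mod_)
open import Data.Integer as ℤ using (ℤ; +_)
import Data.Integer.Divisibility as ℤD
open import Data.Fin as Fin using (Fin; toℕ)
open import Data.Fin.Permutation using (Permutation′; _⟨$⟩ʳ_)
open import Data.List using (List; []; _∷_)
open import Data.Vec using (Vec; []; _∷_; tabulate; lookup)
import Data.Vec.Properties as VecP
open import Data.Product using (Σ; ∃; _×_; _,_)
import Data.Product.Properties as ProdP
open import Data.Unit using (⊤; tt)
open import Relation.Nullary using (¬_; yes; no)
open import Relation.Binary.PropositionalEquality using (_≡_; refl)
open import Relation.Binary.Definitions using (DecidableEquality)

-- The finite abelian group G, presented (structure theorem) as
--   ℤ/(suc e₁) × ℤ/(suc e₂) × … × ℤ/(suc e_r)   for  es = e₁ ∷ … ∷ e_r.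
-- The character group A = G^∨ is presented by the same set, where the
-- element a corresponds to the character  g ↦ pair es a g / ord es  ∈ ℚ/ℤ.

El : List ℕ → Set
El []       = ⊤
El (e ∷ es) = Fin (suc e) × El es

-- |G| (a common multiple of all orders).
ord : List ℕ → ℕ
ord []       = 1
ord (e ∷ es) = suc e ℕ.* ord es

private
  red : (e : ℕ) → ℤ → Fin (suc e)
  red e z = (z ℤ.%ℕ suc e) mod suc e

  zi : ∀ {e} → Fin (suc e) → ℤ
  zi x = + toℕ x

0ᴱ : ∀ {es} → El es
0ᴱ {[]}     = tt
0ᴱ {e ∷ es} = Fin.zero , 0ᴱ

infixl 6 _+ᴱ_ _-ᴱ_
infixl 7 _·ᴱ_

_+ᴱ_ : ∀ {es} → El es → El es → El es
_+ᴱ_ {[]}     _ _ = tt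
_+ᴱ_ {e ∷ es} (x , xs) (y , ys) = red e (zi x ℤ.+ zi y) , (xs +ᴱ ys)

-ᴱ_ : ∀ {es} → El es → El es
-ᴱ_ {[]}     _ = tt
-ᴱ_ {e ∷ es} (x , xs) = red e (ℤ.- zi x) , (-ᴱ xs)

_-ᴱ_ : ∀ {es} → El es → El es → El es
x -ᴱ y = x +ᴱ (-ᴱ y)

_·ᴱ_ : ∀ {es} → ℤ → El es → El es
_·ᴱ_ {[]}     _ _ = tt
_·ᴱ_ {e ∷ es} k (x , xs) = red e (k ℤ.* zi x) , (k ·ᴱ xs)

_≟ᴱ_ : ∀ {es} → DecidableEquality (El es)
_≟ᴱ_ {[]}     tt tt = yes refl
_≟ᴱ_ {e ∷ es} = ProdP.≡-dec Fin._≟_ _≟ᴱ_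

-- Pairing A × G → ℚ/ℤ: ⟨a , g⟩ = pair es a g / ord es  (mod 1), i.e.
-- pair es a g = Σᵢ aᵢ gᵢ ∏_{j≠i} (suc eⱼ).
pair : (es : List ℕ) → El es → El es → ℕ
pair []       _ _ = 0
pair (e ∷ es) (a , as) (g , gs) =
  toℕ a ℕ.* toℕ g ℕ.* ord es ℕ.+ suc e ℕ.* pair es as gs

lincomb : ∀ {es n} → Vec ℤ n → Vec (El es) n → El es
lincomb []       []       = 0ᴱ
lincomb (k ∷ ks) (c ∷ cs) = k ·ᴱ c +ᴱ lincomb ks cs

Spans : ∀ {es n} → Vec (El es) n → Set
Spans {es} {n} c = (a : El es) → ∃ λ (k : Vec ℤ n) → a ≡ lincomb k c

InCyc : ∀ {es} → El es → El es → Set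
InCyc g₀ g = ∃ λ (m : ℤ) → g ≡ m ·ᴱ g₀

ProperCyc : ∀ {es} → El es → Set
ProperCyc {es} g₀ = ∃ λ (g : El es) → ¬ InCyc g₀ g

InA'' : ∀ {es} → El es → El es → Set
InA'' {es} g₀ a = (g : El es) → InCyc g₀ g → ord es ℕD.∣ pair es a g
  where import Data.Nat.Divisibility as ℕD

SpansA'' : ∀ {es n} → El es → Vec (El es) n → Set
SpansA'' {es} {n} g₀ b =
  (a : El es) → InA'' g₀ a → ∃ λ (k : Vec ℤ n) → a ≡ lincomb k b

-- congruence of ℚ/ℤ-values written with denominator ord es
_≡[_]_ : ℤ → ℕ → ℤ → Set
x ≡[ L ] y = (+ L) ℤD.∣ (x ℤ.- y)

-- A character of G' (a homomorphism G' → ℚ/ℤ), given by χ g / ord es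
-- for g ∈ G' (values of χ outside G' are irrelevant). Every homomorphism
-- G' → ℚ/ℤ takes values in (1/ord es)ℤ/ℤ, so this covers all of (G')^∨.
IsCharG' : ∀ {es} → El es → (El es → ℤ) → Set
IsCharG' {es} g₀ χ = (g h : El es) → InCyc g₀ g → InCyc g₀ h →
  χ (g +ᴱ h) ≡[ ord es ] (χ g ℤ.+ χ h)

GeneratesDualG' : ∀ {es} → El es → El es → Set
GeneratesDualG' {es} g₀ a = (χ : El es → ℤ) → IsCharG' g₀ χ →
  ∃ λ (k : ℤ) → (g : El es) → InCyc g₀ g →
    χ g ≡[ ord es ] (k ℤ.* (+ pair es a g))

-- 𝓜_n(G): formal ℤ-combinations of n-tuples modulo (O) and (M).

Tuple : List ℕ → ℕ → Set
Tuple es n = Vec (El es) n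

FSum : List ℕ → ℕ → Set
FSum es n = List (ℤ × Tuple es n)

coeff : ∀ {es n} → Tuple es n → FSum es n → ℤ
coeff t [] = + 0
coeff t ((z , t′) ∷ s) with VecP.≡-dec _≟ᴱ_ t t′
... | yes _ = z ℤ.+ coeff t s
... | no  _ = coeff t s

permute : ∀ {es n} → Permutation′ n → Tuple es n → Tuple es n
permute σ c = tabulate (λ i → lookup c (σ ⟨$⟩ʳ i))

data Rel (es : List ℕ) : ℕ → Set where
  relO : ∀ {n} (c : Tuple es n) → Spans c → Permutation′ n → Rel es n
  relM : ∀ {m} (c₁ c₂ : El es) (cs : Tuple es m) → Spans (c₁ ∷ c₂ ∷ cs) →
         Rel es (suc (suc m))

relSum : ∀ {es n} → Rel es n → FSum es n
relSum (relO c _ σ) = (+ 1 , c) ∷ (ℤ.- + 1 , permute σ c) ∷ []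
relSum (relM c₁ c₂ cs _) =
  (+ 1 , c₁ ∷ c₂ ∷ cs) ∷ (ℤ.- + 1 , (c₁ -ᴱ c₂) ∷ c₂ ∷ cs)
    ∷ (ℤ.- + 1 , c₁ ∷ (c₂ -ᴱ c₁) ∷ cs) ∷ []

combine : ∀ {es n} → Tuple es n → List (ℤ × Rel es n) → ℤ
combine t [] = + 0
combine t ((z , r) ∷ rs) = z ℤ.* coeff t (relSum r) ℤ.+ combine t rs

EqM : ∀ {es n} → FSum es n → FSum es n → Set
EqM {es} {n} x y = ∃ λ (rs : List (ℤ × Rel es n)) →
  (t : Tuple es n) → coeff t x ℤ.- coeff t y ≡ combine t rs

{-# OPTIONS --safe #-}
-- Write ⟨± a , b⟩ for ⟨a, b⟩ + ⟨−a, b⟩. Relation (M) at (a + β, β, r) and at (−a, β, r),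
-- together with the transposition ⟨a + β, −a, r⟩ = ⟨−a, a + β, r⟩, gives
-- ⟨± a , β ∷ r⟩ = ⟨± a + β , β ∷ r⟩. Permuting the tail brings any bⱼ into second position,
-- so ⟨± a , b⟩ is unchanged when a is translated by the subgroup generated by b, and
-- a₂ − a₁ ∈ A'' lies in that subgroup. All tuples involved generate A because a₁ ∷ b does:
-- pairing with x ∈ A is a character of G', hence equals k times the restriction of a₁ for
-- some k, so x − k a₁ ∈ A'' is a combination of b.
module Submission where

open import Defs
open import Level using (0ℓ)
open import Data.Nat as ℕ using (ℕ; zero; suc; _≤_)
import Data.Nat.Properties as ℕP
import Data.Nat.Divisibility as ℕD
open import Data.Nat.DivMod as ℕDM using (_mod_)
open import Data.Integer as ℤ using (ℤ; +_; -[1+_]; _+_; _-_; _*_; -_; 1ℤ; -1ℤ)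
import Data.Integer.Properties as ℤP
import Data.Integer.DivMod as ℤDM
open import Data.Integer.Divisibility.Signed
  using (_∣_; divides; ∣ᵤ⇒∣; ∣⇒∣ᵤ; ∣m∣n⇒∣m+n; ∣m⇒∣-m; ∣n⇒∣m*n)
open import Data.Integer.Tactic.RingSolver using (solve-∀)
open import Data.Fin using (Fin; zero; suc; toℕ)
import Data.Fin.Properties as FinP
open import Data.Fin.Permutation using (Permutation′; _⟨$⟩ˡ_; transpose; lift₀; inverseʳ)
open import Data.List as List using (List; []; _∷_; _++_)
open import Data.Vec as Vec using (Vec; []; _∷_; lookup; replicate; zipWith)
import Data.Vec.Properties as VecP
open import Data.Vec.Relation.Unary.All using (All)
open import Data.Product as Product using (∃; _×_; _,_)
open import Function using (_∘_)
open import Algebra.Bundles using (AbelianGroup)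
open import Algebra.Structures using (IsAbelianGroup)
open import Algebra.Consequences.Propositional using (comm∧idˡ⇒id; comm∧invʳ⇒inv)
import Algebra.Properties.AbelianGroup as AbelianGroupProperties
open import Algebra.Properties.CommutativeSemigroup using (interchange)
open import Relation.Nullary using (yes; no; contradiction)
open import Relation.Binary.Bundles using (Setoid)
open import Relation.Binary.Structures using (IsEquivalence)
open import Relation.Binary.PropositionalEquality
open import Relation.Binary.PropositionalEquality.Algebra using (isMagma)

infix 4 _≡_[mod_]
record _≡_[mod_] (x y : ℤ) (n : ℕ) : Set where
  constructor mod-witness
  field divides-difference : + n ∣ x - y

private
  ∣-resp : ∀ {k x y} → x ≡ y → k ∣ x → k ∣ y
  ∣-resp = subst (_ ∣_)

module _ {n : ℕ} where

  ≡⇒≡-mod : ∀ {x y} → x ≡ y → x ≡ y [mod n ]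
  ≡⇒≡-mod {x} refl = mod-witness (divides (+ 0) (ℤP.+-inverseʳ x))

  ≡-mod-refl : ∀ {x} → x ≡ x [mod n ]
  ≡-mod-refl = ≡⇒≡-mod refl

  ≡-mod-sym : ∀ {x y} → x ≡ y [mod n ] → y ≡ x [mod n ]
  ≡-mod-sym {x} {y} (mod-witness p) = mod-witness (∣-resp (neg-diff x y) (∣m⇒∣-m p))
    where
    neg-diff : ∀ x y → - (x - y) ≡ y - x
    neg-diff = solve-∀

  ≡-mod-trans : ∀ {x y z} → x ≡ y [mod n ] → y ≡ z [mod n ] → x ≡ z [mod n ]
  ≡-mod-trans {x} {y} {z} (mod-witness p) (mod-witness q) =
    mod-witness (∣-resp (ℤP.+-minus-telescope x y z) (∣m∣n⇒∣m+n p q))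

  ≡-mod-isEquivalence : IsEquivalence (_≡_[mod n ])
  ≡-mod-isEquivalence = record
    { refl = ≡-mod-refl ; sym = ≡-mod-sym ; trans = ≡-mod-trans }

  +-cong-mod : ∀ {x x′ y y′} → x ≡ x′ [mod n ] → y ≡ y′ [mod n ] →
               x + y ≡ x′ + y′ [mod n ]
  +-cong-mod {x} {x′} {y} {y′} (mod-witness p) (mod-witness q) =
    mod-witness (∣-resp (diff-+ x x′ y y′) (∣m∣n⇒∣m+n p q))
    where
    diff-+ : ∀ x x′ y y′ → (x - x′) + (y - y′) ≡ (x + y) - (x′ + y′)
    diff-+ = solve-∀

  *-congˡ-mod : ∀ k {x y} → x ≡ y [mod n ] → k * x ≡ k * y [mod n ]
  *-congˡ-mod k {x} {y} (mod-witness p) = mod-witness (∣-resp (diff-* k x y) (∣n⇒∣m*n k p))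
    where
    diff-* : ∀ k x y → k * (x - y) ≡ k * x - k * y
    diff-* = solve-∀

  *-scale-mod : ∀ m {x y} → x ≡ y [mod n ] → + m * x ≡ + m * y [mod m ℕ.* n ]
  *-scale-mod m {x} {y} (mod-witness (divides q eq)) = mod-witness (divides q (begin
    + m * x - + m * y    ≡⟨ diff-* (+ m) x y ⟩
    + m * (x - y)        ≡⟨ cong (+ m *_) eq ⟩
    + m * (q * + n)      ≡⟨ reassoc (+ m) q (+ n) ⟩
    q * (+ m * + n)      ≡⟨ cong (q *_) (ℤP.pos-* m n) ⟨
    q * + (m ℕ.* n)      ∎))
    where
    open ≡-Reasoning
    diff-* : ∀ k x y → k * x - k * y ≡ k * (x - y)
    diff-* = solve-∀
    reassoc : ∀ m q n → m * (q * n) ≡ q * (m * n)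
    reassoc = solve-∀

  *-scale-mod′ : ∀ m {x y} → x ≡ y [mod n ] → + m * x ≡ + m * y [mod n ℕ.* m ]
  *-scale-mod′ m {x} {y} p =
    subst (λ k → + m * x ≡ + m * y [mod k ]) (ℕP.*-comm m n) (*-scale-mod m p)

≡-mod-setoid : ℕ → Setoid _ _
≡-mod-setoid n = record { isEquivalence = ≡-mod-isEquivalence {n} }

module ≡-mod-Reasoning (n : ℕ) where
  open import Relation.Binary.Reasoning.Setoid (≡-mod-setoid n) public

private
  multiple<⇒≡0 : ∀ {d m} → d ℕD.∣ m → m ℕ.< d → m ≡ 0
  multiple<⇒≡0 {m = zero}  _   _   = refl
  multiple<⇒≡0 {m = suc m} d∣m m<d = contradiction d∣m (ℕD.>⇒∤ m<d)

residue-unique : ∀ {d r s} → r ℕ.< d → s ℕ.< d → + r ≡ + s [mod d ] → r ≡ s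
residue-unique {d} {r} {s} r<d s<d (mod-witness d∣r-s) =
  ℤP.+-injective (ℤP.i-j≡0⇒i≡j (+ r) (+ s)
    (ℤP.∣i∣≡0⇒i≡0 (multiple<⇒≡0 (∣⇒∣ᵤ d∣r-s) ∣r-s∣<d)))
  where
  ∣r-s∣<d : ℤ.∣ + r - + s ∣ ℕ.< d
  ∣r-s∣<d = subst (ℕ._< d) (cong ℤ.∣_∣ (sym (ℤP.m-n≡m⊖n r s)))
              (ℕP.≤-<-trans (ℤP.∣m⊝n∣≤m⊔n r s) (ℕP.⊔-lub r<d s<d))

+-multiple-mod : ∀ {n} x q → x + q * + n ≡ x [mod n ]
+-multiple-mod {n} x q = mod-witness (divides q (cancel x (q * + n)))
  where
  cancel : ∀ x y → x + y - x ≡ y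
  cancel = solve-∀

≡[]⇒≡-mod : ∀ {n x y} → x ≡[ n ] y → x ≡ y [mod n ]
≡[]⇒≡-mod p = mod-witness (∣ᵤ⇒∣ p)

≡-mod⇒≡[] : ∀ {n x y} → x ≡ y [mod n ] → x ≡[ n ] y
≡-mod⇒≡[] (mod-witness p) = ∣⇒∣ᵤ p

≡0-mod⇒∣ : ∀ {n m} → + m ≡ + 0 [mod n ] → n ℕD.∣ m
≡0-mod⇒∣ {n} {m} (mod-witness p) = ∣⇒∣ᵤ (∣-resp (ℤP.+-identityʳ (+ m)) p)

-- Definitionally the reduction map hidden in Defs, so _+ᴱ_, -ᴱ_ and _·ᴱ_ unfold to it.
fromℤ : (e : ℕ) → ℤ → Fin (suc e)
fromℤ e z = (z ℤ.%ℕ suc e) mod suc e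

toℤ : ∀ {e} → Fin (suc e) → ℤ
toℤ x = + toℕ x

toℕ-fromℤ : ∀ e z → toℕ (fromℤ e z) ≡ z ℤ.%ℕ suc e
toℕ-fromℤ e z = trans (FinP.toℕ-fromℕ< _) (ℕDM.m<n⇒m%n≡m (ℤDM.n%ℕd<d z (suc e)))

fromℤ-toℤ : ∀ {e} (x : Fin (suc e)) → fromℤ e (toℤ x) ≡ x
fromℤ-toℤ {e} x =
  FinP.toℕ-injective (trans (toℕ-fromℤ e (toℤ x)) (ℕDM.m<n⇒m%n≡m (FinP.toℕ<n x)))

toℤ-fromℤ : ∀ e z → toℤ (fromℤ e z) ≡ z [mod suc e ]
toℤ-fromℤ e z = begin
  toℤ (fromℤ e z)                   ≈⟨ +-multiple-mod (toℤ (fromℤ e z)) q ⟨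
  toℤ (fromℤ e z) + q * + suc e     ≡⟨ cong (λ r → + r + q * + suc e) (toℕ-fromℤ e z) ⟩
  + (z ℤ.%ℕ suc e) + q * + suc e    ≡⟨ ℤDM.a≡a%ℕn+[a/ℕn]*n z (suc e) ⟨
  z                                 ∎
  where
  open ≡-mod-Reasoning (suc e)
  q : ℤ
  q = z ℤ./ℕ suc e

fromℤ-cong : ∀ e {z z′} → z ≡ z′ [mod suc e ] → fromℤ e z ≡ fromℤ e z′
fromℤ-cong e {z} {z′} z≡z′ = FinP.toℕ-injective (residue-unique
  (FinP.toℕ<n (fromℤ e z)) (FinP.toℕ<n (fromℤ e z′))
  (begin
    toℤ (fromℤ e z)   ≈⟨ toℤ-fromℤ e z ⟩
    z                 ≈⟨ z≡z′ ⟩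
    z′                ≈⟨ toℤ-fromℤ e z′ ⟨
    toℤ (fromℤ e z′)  ∎))
  where open ≡-mod-Reasoning (suc e)

+ᴱ-comm : ∀ {es} (x y : El es) → x +ᴱ y ≡ y +ᴱ x
+ᴱ-comm {[]}     _        _        = refl
+ᴱ-comm {e ∷ es} (x , xs) (y , ys) =
  cong₂ _,_ (cong (fromℤ e) (ℤP.+-comm (toℤ x) (toℤ y))) (+ᴱ-comm xs ys)

+ᴱ-assoc : ∀ {es} (x y z : El es) → (x +ᴱ y) +ᴱ z ≡ x +ᴱ (y +ᴱ z)
+ᴱ-assoc {[]}     _        _        _        = refl
+ᴱ-assoc {e ∷ es} (x , xs) (y , ys) (z , zs) = cong₂ _,_ (fromℤ-cong e (begin
    toℤ (fromℤ e (toℤ x + toℤ y)) + toℤ z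
      ≈⟨ +-cong-mod (toℤ-fromℤ e (toℤ x + toℤ y)) (≡-mod-refl {x = toℤ z}) ⟩
    toℤ x + toℤ y + toℤ z
      ≡⟨ ℤP.+-assoc (toℤ x) (toℤ y) (toℤ z) ⟩
    toℤ x + (toℤ y + toℤ z)
      ≈⟨ +-cong-mod (≡-mod-refl {x = toℤ x}) (toℤ-fromℤ e (toℤ y + toℤ z)) ⟨
    toℤ x + toℤ (fromℤ e (toℤ y + toℤ z))
      ∎))
  (+ᴱ-assoc xs ys zs)
  where open ≡-mod-Reasoning (suc e)

+ᴱ-identityˡ : ∀ {es} (x : El es) → 0ᴱ +ᴱ x ≡ x
+ᴱ-identityˡ {[]}     _        = refl
+ᴱ-identityˡ {e ∷ es} (x , xs) = cong₂ _,_ (fromℤ-toℤ x) (+ᴱ-identityˡ xs)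

+ᴱ-inverseʳ : ∀ {es} (x : El es) → x +ᴱ (-ᴱ x) ≡ 0ᴱ
+ᴱ-inverseʳ {[]}     _        = refl
+ᴱ-inverseʳ {e ∷ es} (x , xs) = cong₂ _,_ (fromℤ-cong e (begin
    toℤ x + toℤ (fromℤ e (- toℤ x))
      ≈⟨ +-cong-mod (≡-mod-refl {x = toℤ x}) (toℤ-fromℤ e (- toℤ x)) ⟩
    toℤ x + - toℤ x
      ≡⟨ ℤP.+-inverseʳ (toℤ x) ⟩
    + 0
      ∎))
  (+ᴱ-inverseʳ xs)
  where open ≡-mod-Reasoning (suc e)

El-isAbelianGroup : ∀ es → IsAbelianGroup _≡_ (_+ᴱ_ {es}) 0ᴱ (-ᴱ_ {es})
El-isAbelianGroup es = record
  { isGroup = record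
    { isMonoid = record
      { isSemigroup = record { isMagma = isMagma _+ᴱ_ ; assoc = +ᴱ-assoc }
      ; identity    = comm∧idˡ⇒id +ᴱ-comm +ᴱ-identityˡ
      }
    ; inverse = comm∧invʳ⇒inv +ᴱ-comm +ᴱ-inverseʳ
    ; ⁻¹-cong = cong (-ᴱ_ {es})
    }
  ; comm = +ᴱ-comm
  }

El-abelianGroup : List ℕ → AbelianGroup 0ℓ 0ℓ
El-abelianGroup es = record { isAbelianGroup = El-isAbelianGroup es }

module _ {es : List ℕ} where
  open AbelianGroup (El-abelianGroup es) public
    using (identityʳ; comm)
  open AbelianGroupProperties (El-abelianGroup es) public
    using ( ⁻¹-involutive; ε⁻¹≈ε; ⁻¹-∙-comm; ⁻¹-anti-homo‿-; inverseˡ-unique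
          ; //-rightDividesˡ; //-rightDividesʳ)

·ᴱ-zeroˡ : ∀ {es} (x : El es) → + 0 ·ᴱ x ≡ 0ᴱ
·ᴱ-zeroˡ {[]}     _        = refl
·ᴱ-zeroˡ {e ∷ es} (x , xs) = cong (zero ,_) (·ᴱ-zeroˡ xs)

·ᴱ-identityˡ : ∀ {es} (x : El es) → + 1 ·ᴱ x ≡ x
·ᴱ-identityˡ {[]}     _        = refl
·ᴱ-identityˡ {e ∷ es} (x , xs) =
  cong₂ _,_ (trans (cong (fromℤ e) (ℤP.*-identityˡ (toℤ x))) (fromℤ-toℤ x)) (·ᴱ-identityˡ xs)

·ᴱ-distribʳ : ∀ {es} k l (x : El es) → (k + l) ·ᴱ x ≡ k ·ᴱ x +ᴱ l ·ᴱ x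
·ᴱ-distribʳ {[]}     _ _ _        = refl
·ᴱ-distribʳ {e ∷ es} k l (x , xs) = cong₂ _,_ (fromℤ-cong e (begin
    (k + l) * toℤ x
      ≡⟨ ℤP.*-distribʳ-+ (toℤ x) k l ⟩
    k * toℤ x + l * toℤ x
      ≈⟨ +-cong-mod (toℤ-fromℤ e (k * toℤ x)) (toℤ-fromℤ e (l * toℤ x)) ⟨
    toℤ (fromℤ e (k * toℤ x)) + toℤ (fromℤ e (l * toℤ x))
      ∎))
  (·ᴱ-distribʳ k l xs)
  where open ≡-mod-Reasoning (suc e)

·ᴱ-neg : ∀ {es} k (x : El es) → (- k) ·ᴱ x ≡ -ᴱ (k ·ᴱ x)
·ᴱ-neg k x = inverseˡ-unique ((- k) ·ᴱ x) (k ·ᴱ x) (begin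
  (- k) ·ᴱ x +ᴱ k ·ᴱ x  ≡⟨ ·ᴱ-distribʳ (- k) k x ⟨
  (- k + k) ·ᴱ x        ≡⟨ cong (_·ᴱ x) (ℤP.+-inverseˡ k) ⟩
  + 0 ·ᴱ x              ≡⟨ ·ᴱ-zeroˡ x ⟩
  0ᴱ                    ∎)
  where open ≡-Reasoning

pairℤ : (es : List ℕ) → El es → El es → ℤ
pairℤ es a g = + pair es a g

pairℤ-∷ : ∀ e es a as g gs →
  pairℤ (e ∷ es) (a , as) (g , gs) ≡ + ord es * (toℤ g * toℤ a) + + suc e * pairℤ es as gs
pairℤ-∷ e es a as g gs = begin
  + (toℕ a ℕ.* toℕ g ℕ.* ord es ℕ.+ suc e ℕ.* pair es as gs)
    ≡⟨ ℤP.pos-+ (toℕ a ℕ.* toℕ g ℕ.* ord es) _ ⟩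
  + (toℕ a ℕ.* toℕ g ℕ.* ord es) + + (suc e ℕ.* pair es as gs)
    ≡⟨ cong₂ _+_ first (ℤP.pos-* (suc e) _) ⟩
  + ord es * (toℤ g * toℤ a) + + suc e * pairℤ es as gs
    ∎
  where
  open ≡-Reasoning
  first : + (toℕ a ℕ.* toℕ g ℕ.* ord es) ≡ + ord es * (toℤ g * toℤ a)
  first = begin
    + (toℕ a ℕ.* toℕ g ℕ.* ord es)   ≡⟨ cong +_ (ℕP.*-comm (toℕ a ℕ.* toℕ g) (ord es)) ⟩
    + (ord es ℕ.* (toℕ a ℕ.* toℕ g)) ≡⟨ cong (λ m → + (ord es ℕ.* m)) (ℕP.*-comm (toℕ a) (toℕ g)) ⟩
    + (ord es ℕ.* (toℕ g ℕ.* toℕ a)) ≡⟨ ℤP.pos-* (ord es) _ ⟩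
    + ord es * + (toℕ g ℕ.* toℕ a)   ≡⟨ cong (+ ord es *_) (ℤP.pos-* (toℕ g) (toℕ a)) ⟩
    + ord es * (toℤ g * toℤ a)       ∎

pair-comm : ∀ es a g → pair es a g ≡ pair es g a
pair-comm []       _        _        = refl
pair-comm (e ∷ es) (a , as) (g , gs) =
  cong₂ (λ m n → m ℕ.* ord es ℕ.+ suc e ℕ.* n) (ℕP.*-comm (toℕ a) (toℕ g)) (pair-comm es as gs)

private
  ∷-cong-mod : ∀ e es (g : Fin (suc e)) {u v p q : ℤ} → u ≡ v [mod suc e ] → p ≡ q [mod ord es ] →
    + ord es * (toℤ g * u) + + suc e * p ≡ + ord es * (toℤ g * v) + + suc e * q [mod ord (e ∷ es) ]
  ∷-cong-mod e es g u≡v p≡q =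
    +-cong-mod (*-scale-mod′ (ord es) (*-congˡ-mod (toℤ g) u≡v)) (*-scale-mod (suc e) p≡q)

pairℤ-+ˡ : ∀ es (x y g : El es) → pairℤ es (x +ᴱ y) g ≡ pairℤ es x g + pairℤ es y g [mod ord es ]
pairℤ-+ˡ []       _        _        _        = ≡-mod-refl
pairℤ-+ˡ (e ∷ es) (x , xs) (y , ys) (g , gs) = begin
  pairℤ (e ∷ es) ((x , xs) +ᴱ (y , ys)) (g , gs)
    ≡⟨ pairℤ-∷ e es _ (xs +ᴱ ys) g gs ⟩
  O * (G * toℤ (fromℤ e (X + Y))) + D * pairℤ es (xs +ᴱ ys) gs
    ≈⟨ ∷-cong-mod e es g (toℤ-fromℤ e (X + Y)) (pairℤ-+ˡ es xs ys gs) ⟩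
  O * (G * (X + Y)) + D * (pairℤ es xs gs + pairℤ es ys gs)
    ≡⟨ distrib O G D X Y (pairℤ es xs gs) (pairℤ es ys gs) ⟩
  (O * (G * X) + D * pairℤ es xs gs) + (O * (G * Y) + D * pairℤ es ys gs)
    ≡⟨ cong₂ _+_ (pairℤ-∷ e es x xs g gs) (pairℤ-∷ e es y ys g gs) ⟨
  pairℤ (e ∷ es) (x , xs) (g , gs) + pairℤ (e ∷ es) (y , ys) (g , gs)
    ∎
  where
  open ≡-mod-Reasoning (ord (e ∷ es))
  O D G X Y : ℤ
  O = + ord es; D = + suc e; G = toℤ g; X = toℤ x; Y = toℤ y
  distrib : ∀ O G D X Y P Q →
    O * (G * (X + Y)) + D * (P + Q) ≡ (O * (G * X) + D * P) + (O * (G * Y) + D * Q)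
  distrib = solve-∀

pairℤ-·ˡ : ∀ es k (x g : El es) → pairℤ es (k ·ᴱ x) g ≡ k * pairℤ es x g [mod ord es ]
pairℤ-·ˡ []       k _        _        = ≡⇒≡-mod (sym (ℤP.*-zeroʳ k))
pairℤ-·ˡ (e ∷ es) k (x , xs) (g , gs) = begin
  pairℤ (e ∷ es) (k ·ᴱ (x , xs)) (g , gs)
    ≡⟨ pairℤ-∷ e es _ (k ·ᴱ xs) g gs ⟩
  O * (G * toℤ (fromℤ e (k * X))) + D * pairℤ es (k ·ᴱ xs) gs
    ≈⟨ ∷-cong-mod e es g (toℤ-fromℤ e (k * X)) (pairℤ-·ˡ es k xs gs) ⟩
  O * (G * (k * X)) + D * (k * pairℤ es xs gs)
    ≡⟨ distrib O G D k X (pairℤ es xs gs) ⟩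
  k * (O * (G * X) + D * pairℤ es xs gs)
    ≡⟨ cong (k *_) (pairℤ-∷ e es x xs g gs) ⟨
  k * pairℤ (e ∷ es) (x , xs) (g , gs)
    ∎
  where
  open ≡-mod-Reasoning (ord (e ∷ es))
  O D G X : ℤ
  O = + ord es; D = + suc e; G = toℤ g; X = toℤ x
  distrib : ∀ O G D k X P → O * (G * (k * X)) + D * (k * P) ≡ k * (O * (G * X) + D * P)
  distrib = solve-∀

pairℤ-+ʳ : ∀ es (x g h : El es) → pairℤ es x (g +ᴱ h) ≡ pairℤ es x g + pairℤ es x h [mod ord es ]
pairℤ-+ʳ es x g h = begin
  pairℤ es x (g +ᴱ h)          ≡⟨ cong +_ (pair-comm es x (g +ᴱ h)) ⟩
  pairℤ es (g +ᴱ h) x          ≈⟨ pairℤ-+ˡ es g h x ⟩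
  pairℤ es g x + pairℤ es h x  ≡⟨ cong₂ (λ m n → + m + + n) (pair-comm es g x) (pair-comm es h x) ⟩
  pairℤ es x g + pairℤ es x h  ∎
  where open ≡-mod-Reasoning (ord es)

infixl 6 _+ᴳ_

data Generated {es n} (c : Vec (El es) n) : El es → Set where
  generator : (i : Fin n) → Generated c (lookup c i)
  0ᴳ        : Generated c 0ᴱ
  _+ᴳ_      : ∀ {x y} → Generated c x → Generated c y → Generated c (x +ᴱ y)
  -ᴳ_       : ∀ {x} → Generated c x → Generated c (-ᴱ x)

Generates : ∀ {es n} → Vec (El es) n → Set
Generates {es} c = (x : El es) → Generated c x

module _ {es n} {c : Vec (El es) n} where

  infixr 7 _·ᴳ_

  ℕ·ᴳ : ∀ m {x} → Generated c x → Generated c (+ m ·ᴱ x)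
  ℕ·ᴳ zero    {x} _  = subst (Generated c) (sym (·ᴱ-zeroˡ x)) 0ᴳ
  ℕ·ᴳ (suc m) {x} gx = subst (Generated c) (sym (·ᴱ-distribʳ (+ 1) (+ m) x))
    (subst (Generated c) (sym (·ᴱ-identityˡ x)) gx +ᴳ ℕ·ᴳ m gx)

  _·ᴳ_ : ∀ k {x} → Generated c x → Generated c (k ·ᴱ x)
  _·ᴳ_ (+ m)      gx = ℕ·ᴳ m gx
  _·ᴳ_ -[1+ m ] {x} gx = subst (Generated c) (sym (·ᴱ-neg (+ suc m) x)) (-ᴳ ℕ·ᴳ (suc m) gx)

  lincomb-generated : ∀ {m} (d : Vec (El es) m) → (∀ i → Generated c (lookup d i)) →
    (k : Vec ℤ m) → Generated c (lincomb k d)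
  lincomb-generated []       _   []       = 0ᴳ
  lincomb-generated (_ ∷ ds) gen (k ∷ ks) =
    k ·ᴳ gen zero +ᴳ lincomb-generated ds (gen ∘ suc) ks

Generated-mono : ∀ {es n m} {c : Vec (El es) n} {d : Vec (El es) m} →
  (∀ i → Generated d (lookup c i)) → ∀ {x} → Generated c x → Generated d x
Generated-mono c⊆d (generator i) = c⊆d i
Generated-mono c⊆d 0ᴳ            = 0ᴳ
Generated-mono c⊆d (gx +ᴳ gy)    = Generated-mono c⊆d gx +ᴳ Generated-mono c⊆d gy
Generated-mono c⊆d (-ᴳ gx)       = -ᴳ Generated-mono c⊆d gx

Generates-mono : ∀ {es n m} {c : Vec (El es) n} {d : Vec (El es) m} →
  (∀ i → Generated d (lookup c i)) → Generates c → Generates d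
Generates-mono c⊆d gen x = Generated-mono c⊆d (gen x)

module _ {es : List ℕ} where

  lincomb-zero : ∀ {m} (d : Vec (El es) m) → lincomb (replicate m (+ 0)) d ≡ 0ᴱ
  lincomb-zero []       = refl
  lincomb-zero (d ∷ ds) = trans (cong₂ _+ᴱ_ (·ᴱ-zeroˡ d) (lincomb-zero ds)) (identityʳ 0ᴱ)

  lincomb-+ : ∀ {m} (d : Vec (El es) m) k l →
    lincomb (zipWith _+_ k l) d ≡ lincomb k d +ᴱ lincomb l d
  lincomb-+ []       []       []       = sym (identityʳ 0ᴱ)
  lincomb-+ (d ∷ ds) (k ∷ ks) (l ∷ ls) =
    trans (cong₂ _+ᴱ_ (·ᴱ-distribʳ k l d) (lincomb-+ ds ks ls))
          (interchange (AbelianGroup.commutativeSemigroup (El-abelianGroup es)) _ _ _ _)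

  lincomb-neg : ∀ {m} (d : Vec (El es) m) k → lincomb (Vec.map (λ z → - z) k) d ≡ -ᴱ lincomb k d
  lincomb-neg []       []       = sym ε⁻¹≈ε
  lincomb-neg (d ∷ ds) (k ∷ ks) = trans (cong₂ _+ᴱ_ (·ᴱ-neg k d) (lincomb-neg ds ks)) (⁻¹-∙-comm _ _)

unit : ∀ {m} → Fin m → Vec ℤ m
unit {suc m} zero    = + 1 ∷ replicate m (+ 0)
unit         (suc i) = + 0 ∷ unit i

lincomb-unit : ∀ {es m} (d : Vec (El es) m) i → lincomb (unit i) d ≡ lookup d i
lincomb-unit (d ∷ ds) zero    = trans (cong₂ _+ᴱ_ (·ᴱ-identityˡ d) (lincomb-zero ds)) (identityʳ d)
lincomb-unit (d ∷ ds) (suc i) = trans (cong₂ _+ᴱ_ (·ᴱ-zeroˡ d) (lincomb-unit ds i)) (+ᴱ-identityˡ _)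

Generated⇒lincomb : ∀ {es n} {c : Vec (El es) n} {x} → Generated c x → ∃ λ k → x ≡ lincomb k c
Generated⇒lincomb {c = c} (generator i) = unit i , sym (lincomb-unit c i)
Generated⇒lincomb {n = n} {c = c} 0ᴳ    = replicate n (+ 0) , sym (lincomb-zero c)
Generated⇒lincomb {c = c} (gx +ᴳ gy) with Generated⇒lincomb gx | Generated⇒lincomb gy
... | k , x≡ | l , y≡ = zipWith _+_ k l , trans (cong₂ _+ᴱ_ x≡ y≡) (sym (lincomb-+ c k l))
Generated⇒lincomb {c = c} (-ᴳ gx) with Generated⇒lincomb gx
... | k , x≡ = Vec.map (λ z → - z) k , trans (cong -ᴱ_ x≡) (sym (lincomb-neg c k))

Generates⇒Spans : ∀ {es n} {c : Vec (El es) n} → Generates c → Spans c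
Generates⇒Spans gen x = Generated⇒lincomb (gen x)

pairℤ-isCharG' : ∀ {es} (g₀ x : El es) → IsCharG' g₀ (pairℤ es x)
pairℤ-isCharG' {es} g₀ x g h _ _ = ≡-mod⇒≡[] (pairℤ-+ʳ es x g h)

agreesOnG'⇒sub∈A'' : ∀ {es} (g₀ x a : El es) k →
  ((g : El es) → InCyc g₀ g → pairℤ es x g ≡ k * pairℤ es a g [mod ord es ]) →
  InA'' g₀ (x -ᴱ k ·ᴱ a)
agreesOnG'⇒sub∈A'' {es} g₀ x a k agree g g∈G' = ≡0-mod⇒∣ (begin
  pairℤ es (x -ᴱ k ·ᴱ a) g                  ≈⟨ pairℤ-+ˡ es x (-ᴱ (k ·ᴱ a)) g ⟩
  pairℤ es x g + pairℤ es (-ᴱ (k ·ᴱ a)) g   ≡⟨ cong (λ y → pairℤ es x g + pairℤ es y g) (·ᴱ-neg k a) ⟨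
  pairℤ es x g + pairℤ es ((- k) ·ᴱ a) g    ≈⟨ +-cong-mod (agree g g∈G') (pairℤ-·ˡ es (- k) a g) ⟩
  k * pairℤ es a g + - k * pairℤ es a g     ≡⟨ cancel k (pairℤ es a g) ⟩
  + 0                                       ∎)
  where
  open ≡-mod-Reasoning (ord es)
  cancel : ∀ k p → k * p + - k * p ≡ + 0
  cancel = solve-∀

GeneratesDualG'∧SpansA''⇒Generates : ∀ {es k} (g₀ : El es) (b : Vec (El es) k) → SpansA'' g₀ b →
  (a : El es) → GeneratesDualG' g₀ a → Generates (a ∷ b)
GeneratesDualG'∧SpansA''⇒Generates {es} g₀ b spans a dual x
  with dual (pairℤ es x) (pairℤ-isCharG' g₀ x)
... | k , agree
  with spans (x -ᴱ k ·ᴱ a) (agreesOnG'⇒sub∈A'' g₀ x a k (λ g g∈G' → ≡[]⇒≡-mod (agree g g∈G')))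
... | m , x-ka≡mb = subst (Generated (a ∷ b)) (//-rightDividesˡ (k ·ᴱ a) x)
  (subst (Generated (a ∷ b)) (sym x-ka≡mb) (lincomb-generated b (generator ∘ suc) m)
   +ᴳ k ·ᴳ generator zero)

module _ {es : List ℕ} {n : ℕ} where

  private
    negate : List (ℤ × Rel es n) → List (ℤ × Rel es n)
    negate = List.map (Product.map₁ (λ z → - z))

    combine-++ : ∀ (t : Tuple es n) rs rs′ → combine t (rs ++ rs′) ≡ combine t rs + combine t rs′
    combine-++ t []             rs′ = sym (ℤP.+-identityˡ _)
    combine-++ t ((z , r) ∷ rs) rs′ =
      trans (cong (λ w → z * coeff t (relSum r) + w) (combine-++ t rs rs′))
            (sym (ℤP.+-assoc (z * coeff t (relSum r)) (combine t rs) (combine t rs′)))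

    combine-negate : ∀ (t : Tuple es n) rs → combine t (negate rs) ≡ - combine t rs
    combine-negate t []             = refl
    combine-negate t ((z , r) ∷ rs) =
      trans (cong₂ _+_ (sym (ℤP.neg-distribˡ-* z (coeff t (relSum r)))) (combine-negate t rs))
            (sym (ℤP.neg-distrib-+ (z * coeff t (relSum r)) (combine t rs)))

  EqM-refl : ∀ {x : FSum es n} → EqM x x
  EqM-refl {x} = [] , λ t → ℤP.+-inverseʳ (coeff t x)

  EqM-sym : ∀ {x y : FSum es n} → EqM x y → EqM y x
  EqM-sym {x} {y} (rs , x-y≡rs) = negate rs , λ t → begin
    coeff t y - coeff t x       ≡⟨ neg-minus (coeff t x) (coeff t y) ⟨
    - (coeff t x - coeff t y)   ≡⟨ cong -_ (x-y≡rs t) ⟩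
    - combine t rs              ≡⟨ combine-negate t rs ⟨
    combine t (negate rs)       ∎
    where
    open ≡-Reasoning
    neg-minus : ∀ x y → - (x - y) ≡ y - x
    neg-minus = solve-∀

  EqM-trans : ∀ {x y z : FSum es n} → EqM x y → EqM y z → EqM x z
  EqM-trans {x} {y} {z} (rs , x-y≡rs) (rs′ , y-z≡rs′) = rs ++ rs′ , λ t → begin
    coeff t x - coeff t z                            ≡⟨ ℤP.+-minus-telescope (coeff t x) (coeff t y) (coeff t z) ⟨
    (coeff t x - coeff t y) + (coeff t y - coeff t z) ≡⟨ cong₂ _+_ (x-y≡rs t) (y-z≡rs′ t) ⟩
    combine t rs + combine t rs′                     ≡⟨ combine-++ t rs rs′ ⟨
    combine t (rs ++ rs′)                            ∎
    where open ≡-Reasoning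

EqM-setoid : List ℕ → ℕ → Setoid _ _
EqM-setoid es n = record
  { Carrier = FSum es n ; _≈_ = EqM {es} {n}
  ; isEquivalence = record
    { refl  = λ {x} → EqM-refl {x = x}
    ; sym   = λ {x y} → EqM-sym {x = x} {y}
    ; trans = λ {x y z} → EqM-trans {x = x} {y} {z}
    }
  }

module EqM-Reasoning (es : List ℕ) (n : ℕ) where
  open import Relation.Binary.Reasoning.Setoid (EqM-setoid es n) public

δ : ∀ {es n} → Tuple es n → Tuple es n → ℤ
δ t u = coeff t ((1ℤ , u) ∷ [])

δ-expansion : ∀ {es n} → Tuple es n → FSum es n → ℤ
δ-expansion t []             = + 0
δ-expansion t ((z , u) ∷ s) = z * δ t u + δ-expansion t s

coeff≡δ-expansion : ∀ {es n} (t : Tuple es n) s → coeff t s ≡ δ-expansion t s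
coeff≡δ-expansion t []            = refl
coeff≡δ-expansion t ((z , u) ∷ s) with VecP.≡-dec _≟ᴱ_ t u
... | yes _ = cong₂ _+_ (sym (ℤP.*-identityʳ z)) (coeff≡δ-expansion t s)
... | no  _ = trans (coeff≡δ-expansion t s)
                    (sym (trans (cong (_+ δ-expansion t s) (ℤP.*-zeroʳ z)) (ℤP.+-identityˡ _)))

⟨±_,_⟩ : ∀ {es k} → El es → Vec (El es) k → FSum es (suc k)
⟨± a , b ⟩ = (1ℤ , a ∷ b) ∷ (1ℤ , (-ᴱ a) ∷ b) ∷ []

private
  one-one : ∀ A B → 1ℤ * A + (1ℤ * B + + 0) ≡ A + B
  one-one = solve-∀
  one-minus : ∀ A B → 1ℤ * A + (-1ℤ * B + + 0) ≡ A - B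
  one-minus = solve-∀
  one-minus-minus : ∀ A B C → 1ℤ * A + (-1ℤ * B + (-1ℤ * C + + 0)) ≡ A - B - C
  one-minus-minus = solve-∀

module _ {es : List ℕ} where

  coeff-⟨±⟩ : ∀ {k} (t : Tuple es (suc k)) a b →
    coeff t ⟨± a , b ⟩ ≡ δ t (a ∷ b) + δ t ((-ᴱ a) ∷ b)
  coeff-⟨±⟩ t a b =
    trans (coeff≡δ-expansion t ⟨± a , b ⟩) (one-one (δ t (a ∷ b)) (δ t ((-ᴱ a) ∷ b)))

  coeff-relO : ∀ {n} (t : Tuple es n) c (gen : Spans c) σ →
    coeff t (relSum (relO c gen σ)) ≡ δ t c - δ t (permute σ c)
  coeff-relO t c gen σ = trans (coeff≡δ-expansion t _) (one-minus (δ t c) (δ t (permute σ c)))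

  coeff-relM : ∀ {m} (t : Tuple es (suc (suc m))) c₁ c₂ cs (gen : Spans (c₁ ∷ c₂ ∷ cs)) →
    coeff t (relSum (relM c₁ c₂ cs gen))
      ≡ δ t (c₁ ∷ c₂ ∷ cs) - δ t ((c₁ -ᴱ c₂) ∷ c₂ ∷ cs) - δ t (c₁ ∷ (c₂ -ᴱ c₁) ∷ cs)
  coeff-relM t c₁ c₂ cs gen = trans (coeff≡δ-expansion t _)
    (one-minus-minus (δ t (c₁ ∷ c₂ ∷ cs)) (δ t ((c₁ -ᴱ c₂) ∷ c₂ ∷ cs))
                     (δ t (c₁ ∷ (c₂ -ᴱ c₁) ∷ cs)))

module _ {es : List ℕ} {k : ℕ} where

  Generates-neg-head : ∀ {a : El es} {b : Vec (El es) k} → Generates (a ∷ b) → Generates ((-ᴱ a) ∷ b)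
  Generates-neg-head {a} = Generates-mono λ
    { zero    → subst (Generated _) (⁻¹-involutive a) (-ᴳ generator zero)
    ; (suc i) → generator (suc i)
    }

  Generates-shift-head : ∀ {a c : El es} {b : Vec (El es) k} → Generated b c →
    Generates (a ∷ b) → Generates ((a +ᴱ c) ∷ b)
  Generates-shift-head {a} {c} gc = Generates-mono λ
    { zero    → subst (Generated _) (//-rightDividesʳ c a)
                  (generator zero +ᴳ -ᴳ Generated-mono (generator ∘ suc) gc)
    ; (suc i) → generator (suc i)
    }

  Generates-permute-tail : ∀ {a : El es} {b : Vec (El es) k} (σ : Permutation′ k) →
    Generates (a ∷ b) → Generates (a ∷ permute σ b)
  Generates-permute-tail {b = b} σ = Generates-mono λ
    { zero    → generator zero
    ; (suc i) → subst (Generated _) (lookup-permute-inverse i) (generator (suc (σ ⟨$⟩ˡ i)))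
    }
    where
    lookup-permute-inverse : ∀ i → lookup (permute σ b) (σ ⟨$⟩ˡ i) ≡ lookup b i
    lookup-permute-inverse i = trans (VecP.lookup∘tabulate _ (σ ⟨$⟩ˡ i)) (cong (lookup b) (inverseʳ σ))

  ⟨±⟩-permute-tail : ∀ (a : El es) (b : Vec (El es) k) (σ : Permutation′ k) → Generates (a ∷ b) →
    EqM ⟨± a , b ⟩ ⟨± a , permute σ b ⟩
  ⟨±⟩-permute-tail a b σ gen = (1ℤ , O₊) ∷ (1ℤ , O₋) ∷ [] , λ t → begin
    coeff t ⟨± a , b ⟩ - coeff t ⟨± a , b′ ⟩
      ≡⟨ cong₂ _-_ (coeff-⟨±⟩ t a b) (coeff-⟨±⟩ t a b′) ⟩
    (δ t (a ∷ b) + δ t ((-ᴱ a) ∷ b)) - (δ t (a ∷ b′) + δ t ((-ᴱ a) ∷ b′))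
      ≡⟨ regroup (δ t (a ∷ b)) (δ t ((-ᴱ a) ∷ b)) (δ t (a ∷ b′)) (δ t ((-ᴱ a) ∷ b′)) ⟩
    1ℤ * (δ t (a ∷ b) - δ t (a ∷ b′)) + (1ℤ * (δ t ((-ᴱ a) ∷ b) - δ t ((-ᴱ a) ∷ b′)) + + 0)
      ≡⟨ cong₂ (λ p q → 1ℤ * p + (1ℤ * q + + 0))
               (coeff-relO t _ spans₊ (lift₀ σ)) (coeff-relO t _ spans₋ (lift₀ σ)) ⟨
    combine t ((1ℤ , O₊) ∷ (1ℤ , O₋) ∷ [])
      ∎
    where
    open ≡-Reasoning
    b′ : Vec (El es) k
    b′ = permute σ b
    spans₊ : Spans (a ∷ b)
    spans₊ = Generates⇒Spans gen
    spans₋ : Spans ((-ᴱ a) ∷ b)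
    spans₋ = Generates⇒Spans (Generates-neg-head gen)
    O₊ O₋ : Rel es (suc k)
    O₊ = relO (a ∷ b) spans₊ (lift₀ σ)
    O₋ = relO ((-ᴱ a) ∷ b) spans₋ (lift₀ σ)
    regroup : ∀ A B A′ B′ → (A + B) - (A′ + B′) ≡ 1ℤ * (A - A′) + (1ℤ * (B - B′) + + 0)
    regroup = solve-∀

⟨±⟩-shift-by-second : ∀ {es m} (a β : El es) (r : Vec (El es) m) → Generates (a ∷ β ∷ r) →
  EqM ⟨± a , β ∷ r ⟩ ⟨± a +ᴱ β , β ∷ r ⟩
⟨±⟩-shift-by-second {es} {m} a β r gen = (-1ℤ , M₁) ∷ (1ℤ , M₂) ∷ (-1ℤ , O) ∷ [] , difference
  where
  T : El es → El es → Tuple es (suc (suc m))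
  T x y = x ∷ y ∷ r

  spans₁ : Spans (T (a +ᴱ β) β)
  spans₁ = Generates⇒Spans (Generates-shift-head (generator zero) gen)
  spans₂ : Spans (T (-ᴱ a) β)
  spans₂ = Generates⇒Spans (Generates-neg-head gen)
  spans₃ : Spans (T (a +ᴱ β) (-ᴱ a))
  spans₃ = Generates⇒Spans (Generates-mono (λ
    { zero          → subst (Generated _) (⁻¹-involutive a) (-ᴳ generator (suc zero))
    ; (suc zero)    → subst (Generated _) a+β-a≡β (generator zero +ᴳ generator (suc zero))
    ; (suc (suc i)) → generator (suc (suc i))
    }) gen)
    where
    a+β-a≡β : (a +ᴱ β) -ᴱ a ≡ β
    a+β-a≡β = trans (cong (_-ᴱ a) (comm a β)) (//-rightDividesʳ a β)

  M₁ M₂ O : Rel es (suc (suc m))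
  M₁ = relM (a +ᴱ β) β r spans₁
  M₂ = relM (-ᴱ a) β r spans₂
  O  = relO (T (a +ᴱ β) (-ᴱ a)) spans₃ (transpose zero (suc zero))

  module _ (t : Tuple es (suc (suc m))) where
    open ≡-Reasoning

    coeff-M₁ : coeff t (relSum M₁)
             ≡ δ t (T (a +ᴱ β) β) - δ t (T a β) - δ t (T (a +ᴱ β) (-ᴱ a))
    coeff-M₁ = trans (coeff-relM t (a +ᴱ β) β r spans₁)
      (cong₂ (λ x y → δ t (T (a +ᴱ β) β) - δ t (T x β) - δ t (T (a +ᴱ β) y))
             (//-rightDividesʳ β a)
             (trans (sym (⁻¹-anti-homo‿- (a +ᴱ β) β)) (cong -ᴱ_ (//-rightDividesʳ β a))))

    coeff-M₂ : coeff t (relSum M₂)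
             ≡ δ t (T (-ᴱ a) β) - δ t (T (-ᴱ (a +ᴱ β)) β) - δ t (T (-ᴱ a) (a +ᴱ β))
    coeff-M₂ = trans (coeff-relM t (-ᴱ a) β r spans₂)
      (cong₂ (λ x y → δ t (T (-ᴱ a) β) - δ t (T x β) - δ t (T (-ᴱ a) y))
             (⁻¹-∙-comm a β)
             (trans (cong (β +ᴱ_) (⁻¹-involutive a)) (comm β a)))

    coeff-O : coeff t (relSum O) ≡ δ t (T (a +ᴱ β) (-ᴱ a)) - δ t (T (-ᴱ a) (a +ᴱ β))
    coeff-O = trans (coeff-relO t (T (a +ᴱ β) (-ᴱ a)) spans₃ (transpose zero (suc zero)))
      (cong (λ r′ → δ t (T (a +ᴱ β) (-ᴱ a)) - δ t ((-ᴱ a) ∷ (a +ᴱ β) ∷ r′)) (VecP.tabulate∘lookup r))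

    difference : coeff t ⟨± a , β ∷ r ⟩ - coeff t ⟨± a +ᴱ β , β ∷ r ⟩
               ≡ combine t ((-1ℤ , M₁) ∷ (1ℤ , M₂) ∷ (-1ℤ , O) ∷ [])
    difference = begin
      coeff t ⟨± a , β ∷ r ⟩ - coeff t ⟨± a +ᴱ β , β ∷ r ⟩
        ≡⟨ cong₂ _-_ (coeff-⟨±⟩ t a (β ∷ r)) (coeff-⟨±⟩ t (a +ᴱ β) (β ∷ r)) ⟩
      (A + B) - (C + D)
        ≡⟨ regroup A B C D E G ⟩
      -1ℤ * (C - A - E) + (1ℤ * (B - D - G) + (-1ℤ * (E - G) + + 0))
        ≡⟨ cong₂ (λ p q → -1ℤ * p + q) coeff-M₁
                 (cong₂ (λ p q → 1ℤ * p + (-1ℤ * q + + 0)) coeff-M₂ coeff-O) ⟨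
      combine t ((-1ℤ , M₁) ∷ (1ℤ , M₂) ∷ (-1ℤ , O) ∷ [])
        ∎
      where
      A B C D E G : ℤ
      A = δ t (T a β)
      B = δ t (T (-ᴱ a) β)
      C = δ t (T (a +ᴱ β) β)
      D = δ t (T (-ᴱ (a +ᴱ β)) β)
      E = δ t (T (a +ᴱ β) (-ᴱ a))
      G = δ t (T (-ᴱ a) (a +ᴱ β))
      regroup : ∀ A B C D E G →
        (A + B) - (C + D) ≡ -1ℤ * (C - A - E) + (1ℤ * (B - D - G) + (-1ℤ * (E - G) + + 0))
      regroup = solve-∀

⟨±⟩-shift-by-entry : ∀ {es k} (a : El es) (b : Vec (El es) k) (j : Fin k) → Generates (a ∷ b) →
  EqM ⟨± a , b ⟩ ⟨± a +ᴱ lookup b j , b ⟩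
⟨±⟩-shift-by-entry {es} {suc k} a b j gen = begin
  ⟨± a , b ⟩                          ≈⟨ ⟨±⟩-permute-tail a b τ gen ⟩
  ⟨± a , permute τ b ⟩                ≈⟨ ⟨±⟩-shift-by-second a (lookup b j) (Vec.tail (permute τ b))
                                                            (Generates-permute-tail τ gen) ⟩
  ⟨± a +ᴱ lookup b j , permute τ b ⟩  ≈⟨ ⟨±⟩-permute-tail (a +ᴱ lookup b j) b τ
                                                            (Generates-shift-head (generator j) gen) ⟨
  ⟨± a +ᴱ lookup b j , b ⟩            ∎
  where
  open EqM-Reasoning es (suc (suc k))
  τ : Permutation′ (suc k)
  τ = transpose zero j

module _ {es k} {b : Vec (El es) k} where
  open EqM-Reasoning es (suc k)

  ⟨±⟩-shift-by-generated : ∀ {c} → Generated b c → ∀ a → Generates (a ∷ b) →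
    EqM ⟨± a , b ⟩ ⟨± a +ᴱ c , b ⟩
  ⟨±⟩-shift-by-generated (generator j) a gen = ⟨±⟩-shift-by-entry a b j gen
  ⟨±⟩-shift-by-generated 0ᴳ            a gen = begin
    ⟨± a , b ⟩         ≡⟨ cong ⟨±_, b ⟩ (identityʳ a) ⟨
    ⟨± a +ᴱ 0ᴱ , b ⟩   ∎
  ⟨±⟩-shift-by-generated (_+ᴳ_ {x} {y} gx gy) a gen = begin
    ⟨± a , b ⟩              ≈⟨ ⟨±⟩-shift-by-generated gx a gen ⟩
    ⟨± a +ᴱ x , b ⟩         ≈⟨ ⟨±⟩-shift-by-generated gy (a +ᴱ x) (Generates-shift-head gx gen) ⟩
    ⟨± a +ᴱ x +ᴱ y , b ⟩    ≡⟨ cong ⟨±_, b ⟩ (+ᴱ-assoc a x y) ⟩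
    ⟨± a +ᴱ (x +ᴱ y) , b ⟩  ∎
  ⟨±⟩-shift-by-generated (-ᴳ_ {x} gx) a gen = begin
    ⟨± a , b ⟩            ≡⟨ cong ⟨±_, b ⟩ (//-rightDividesˡ x a) ⟨
    ⟨± a -ᴱ x +ᴱ x , b ⟩  ≈⟨ ⟨±⟩-shift-by-generated gx (a -ᴱ x) (Generates-shift-head (-ᴳ gx) gen) ⟨
    ⟨± a -ᴱ x , b ⟩       ∎

lemma4p1 : (es : List ℕ) (k : ℕ) → 1 ≤ k →
    (g₀ : El es) → ProperCyc g₀ →
    (b : Vec (El es) k) → All (InA'' g₀) b → SpansA'' g₀ b →
    (a₁ a₂ : El es) → InA'' g₀ (a₂ -ᴱ a₁) → GeneratesDualG' g₀ a₁ →
    EqM {es} {suc k}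
      ((+ 1 , a₁ ∷ b) ∷ (+ 1 , (-ᴱ a₁) ∷ b) ∷ [])
      ((+ 1 , a₂ ∷ b) ∷ (+ 1 , (-ᴱ a₂) ∷ b) ∷ [])
lemma4p1 es k _ g₀ _ b _ spans a₁ a₂ a₂-a₁∈A'' dual with spans (a₂ -ᴱ a₁) a₂-a₁∈A''
... | m , a₂-a₁≡mb = begin
  ⟨± a₁ , b ⟩                ≈⟨ ⟨±⟩-shift-by-generated a₂-a₁∈⟨b⟩ a₁ a₁∷b-generates ⟩
  ⟨± a₁ +ᴱ (a₂ -ᴱ a₁) , b ⟩  ≡⟨ cong ⟨±_, b ⟩ a₁+[a₂-a₁]≡a₂ ⟩
  ⟨± a₂ , b ⟩                ∎
  where
  open EqM-Reasoning es (suc k)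
  a₂-a₁∈⟨b⟩ : Generated b (a₂ -ᴱ a₁)
  a₂-a₁∈⟨b⟩ = subst (Generated b) (sym a₂-a₁≡mb) (lincomb-generated b generator m)
  a₁∷b-generates : Generates (a₁ ∷ b)
  a₁∷b-generates = GeneratesDualG'∧SpansA''⇒Generates g₀ b spans a₁ dual
  a₁+[a₂-a₁]≡a₂ : a₁ +ᴱ (a₂ -ᴱ a₁) ≡ a₂
  a₁+[a₂-a₁]≡a₂ = trans (comm a₁ (a₂ -ᴱ a₁)) (//-rightDividesˡ a₁ a₂)
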